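{- Let $0<\varepsilon<\frac12$, $\sigma>0$, and let $G$ be an $(\varepsilon,\sigma\log N)$-pseudorandom tournament on $N$ vertices whose edges are coloured red and blue. Suppose $U\subseteq V(G)$ satisfies: (i) the induced graph $G[U]$ has at most $\frac{\varepsilon^2}{32}|U|^2$ blue edges, and (ii) $\frac{\varepsilon}{4}|U|\ge \sigma\log N$. Then $G$ contains a red copy of every oriented tree on $\frac{\varepsilon}{4}|U|$ vertices.
   Context: An oriented graph $G$ is $(\varepsilon,k)$-pseudorandom if for all disjoint sets $A,B\subseteq V(G)$ with $|A|,|B|\ge k$, the number of edges directed from $A$ to $B$ is at least $\varepsilon|A||B|$. A tournament is an orientation of a complete graph; an oriented tree is a tree with each edge given a direction. A red copy of a tree is a subgraph, all of whose edges are red, isomorphic to it as an oriented graph. Logarithms are base $2$.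
   Formalization: The parameters ε and σ are rational. -}

module Defs where

open import Data.Bool using (Bool; true; false; _∧_; _∨_; not; T)
open import Data.Nat as ℕ using (ℕ; _^_; _≤_; _+_)
open import Data.Integer as ℤ using (+_)
open import Data.Rational as ℚ using (ℚ; _/_; ↥_; ↧ₙ_; 0ℚ)
open import Data.Fin using (Fin)
open import Data.Fin.Subset using (Subset; ∣_∣)
open import Data.Vec using (lookup)
open import Data.List using (List; []; _∷_; _++_; [_]; length; map; allFin)
open import Data.Nat.ListAction using (sum)
open import Data.List.Relation.Unary.Unique.Propositional using (Unique)
open import Data.List.Relation.Unary.Linked using (Linked)
open import Data.Product using (Σ; ∃; ∃-syntax; _×_)
open import Function.Definitions using (Injective)
open import Relation.Binary.PropositionalEquality using (_≡_; _≢_)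
open import Relation.Binary.Construct.Closure.ReflexiveTransitive using (Star)
open import Relation.Nullary using (¬_)

ℕ→ℚ : ℕ → ℚ
ℕ→ℚ n = + n / 1

[_]ᵇ : Bool → ℕ
[ true ]ᵇ = 1
[ false ]ᵇ = 0

Σv : ∀ {N} → (Fin N → ℕ) → ℕ
Σv {N} f = sum (map f (allFin N))

-- Digraphs on vertex set Fin N, given by their (Boolean) edge relation.
-- adj i j = true  means there is an edge directed from i to j.

Digraph : ℕ → Set
Digraph N = Fin N → Fin N → Bool

IsOriented : ∀ {N} → Digraph N → Set
IsOriented {N} adj = (i j : Fin N) → ¬ (T (adj i j) × T (adj j i)) × ¬ T (adj i i)

IsTournament : ∀ {N} → Digraph N → Set
IsTournament {N} adj =
  IsOriented adj × ((i j : Fin N) → i ≢ j → T (adj i j ∨ adj j i))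

edgesFromTo : ∀ {N} → Digraph N → Subset N → Subset N → ℕ
edgesFromTo adj A B =
  Σv (λ i → Σv (λ j → [ lookup A i ∧ lookup B j ∧ adj i j ]ᵇ))

Disjoint : ∀ {N} → Subset N → Subset N → Set
Disjoint {N} A B = (i : Fin N) → ¬ (T (lookup A i) × T (lookup B i))

-- "x ≥ σ · log₂ N" for a rational x ≥ 0 and rational σ > 0, written
-- without logarithms: with x = c/d and σ = p/q (lowest terms),
-- c/d ≥ (p/q) log₂ N  ⇔  q c ≥ d p log₂ N  ⇔  N ^ (d p) ≤ 2 ^ (q c).
GeqσLog : (σ : ℚ) (N : ℕ) (x : ℚ) → Set
GeqσLog σ N x =
  (0ℚ ℚ.≤ x) × (N ^ (↧ₙ x ℕ.* ℤ.∣ ↥ σ ∣) ≤ 2 ^ (↧ₙ σ ℕ.* ℤ.∣ ↥ x ∣))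

IsPseudorandomσLog : ∀ {N} → (ε σ : ℚ) → Digraph N → Set
IsPseudorandomσLog {N} ε σ adj =
  (A B : Subset N) → Disjoint A B →
  GeqσLog σ N (ℕ→ℚ ∣ A ∣) → GeqσLog σ N (ℕ→ℚ ∣ B ∣) →
  ε ℚ.* (ℕ→ℚ ∣ A ∣ ℚ.* ℕ→ℚ ∣ B ∣) ℚ.≤ ℕ→ℚ (edgesFromTo adj A B)

-- number of blue edges of G[U]; colour red i j = true means the edge i→j is red
blueEdgesIn : ∀ {N} → Digraph N → (Fin N → Fin N → Bool) → Subset N → ℕ
blueEdgesIn adj red U =
  Σv (λ i → Σv (λ j → [ lookup U i ∧ lookup U j ∧ adj i j ∧ not (red i j) ]ᵇ))

und : ∀ {n} → Digraph n → Fin n → Fin n → Set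
und adj i j = T (adj i j ∨ adj j i)

Connected : ∀ {n} → Digraph n → Set
Connected {n} adj = (i j : Fin n) → Star (und adj) i j

HasCycle : ∀ {n} → Digraph n → Set
HasCycle {n} adj =
  Σ (Fin n) λ v → Σ (List (Fin n)) λ vs →
    Unique (v ∷ vs) × (2 ≤ length vs) × Linked (und adj) (v ∷ vs ++ [ v ])

IsOrientedTree : ∀ {n} → Digraph n → Set
IsOrientedTree adj = IsOriented adj × Connected adj × ¬ HasCycle adj

HasRedCopy : ∀ {n N} → Digraph n → Digraph N → (Fin N → Fin N → Bool) → Set
HasRedCopy {n} {N} tadj adj red =
  Σ (Fin n → Fin N) λ φ → Injective _≡_ _≡_ φ ×
    ((i j : Fin n) → T (tadj i j) → T (adj (φ i) (φ j)) × T (red (φ i) (φ j)))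

-- Write ε = a/b and m = |U|; each rational hypothesis becomes an inequality between natural
-- numbers. Peel U by repeatedly deleting a vertex with fewer than n red out-neighbours or fewer
-- than n red in-neighbours among the vertices not yet deleted. The peeling stops before ⌊m/2⌋
-- deletions, because ⌊m/2⌋ ≥ εm/2: otherwise one of the two kinds of deleted vertices forms a set
-- X with |X| ≥ εm/4, and for the set Y of remaining vertices (|Y| ≥ m/2) pseudorandomness gives
-- at least ε|X||Y| ≥ ε|X|m/2 edges between X and Y in the deficient direction, while at most |X|n
-- of them are red and at most ε²m²/32 ≤ ε|X|m/8 are blue, which is impossible since n ≤ εm/4.
-- So the peeling ends with a nonempty set W in which every vertex has at least n red out- and n
-- red in-neighbours. A tree on n vertices then embeds greedily into the red graph on W: add the
-- tree's vertices one at a time, each joined by a tree edge to an embedded vertex u, and map it to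
-- an unused red out- or in-neighbour of the image of u. Since the tree has no cycle, u is the only
-- embedded neighbour of the new vertex.

module Submission where

open import Defs
open import Data.Bool using (Bool; true; false; _∧_; _∨_; not; T)
open import Data.Bool.Properties using (T?; T-∧; T-∨; ∨-comm)
open import Data.Empty using (⊥; ⊥-elim)
open import Data.Fin as Fin using (Fin; _≟_)
open import Data.Fin.Properties using (any?; all?; ¬∀⟶∃¬)
open import Data.Fin.Subset using (Subset; ∣_∣)
open import Data.Integer as ℤ using (+_; -[1+_]; +≤+)
import Data.Integer.Properties as ℤ
open import Data.List as List using (List; []; _∷_; _++_; [_]; _∷ʳ_; length; map)
open import Data.List.Properties as List using (length-++; length-map)
open import Data.List.Membership.Propositional using (_∈_; _∉_)
open import Data.List.Membership.Propositional.Properties using (∈-++⁻; ∈-map⁺)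
open import Data.List.Relation.Unary.All using ([]; _∷_)
open import Data.List.Relation.Unary.All.Properties using (All¬⇒¬Any; ¬Any⇒All¬)
open import Data.List.Relation.Unary.AllPairs using ([]; _∷_)
open import Data.List.Relation.Unary.Any using (here; there)
import Data.List.Relation.Unary.Any as Any
open import Data.List.Relation.Unary.Linked using (Linked; []; [-]; _∷_)
open import Data.List.Relation.Unary.Unique.Propositional using (Unique)
import Data.List.Relation.Unary.Unique.Propositional.Properties as Unique
open import Data.Nat using (ℕ; zero; suc; _+_; _*_; _^_; _≤_; _<_; _≤?_; _<?_; _<ᵇ_; z≤n; s≤s; z<s;
  NonZero; >-nonZero; ⌊_/2⌋; ⌈_/2⌉)
open import Data.Nat.Coprimality using (Coprime)
open import Data.Nat.Divisibility using (∣1⇒≡1)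
import Data.Nat.ListAction as ListAction
open import Data.Nat.Properties hiding (_≟_)
open import Data.Nat.Tactic.RingSolver using (solve-∀)
open import Algebra.Properties.CommutativeMonoid.Sum +-0-commutativeMonoid
  using (sum; sum-syntax; sum-cong-≗; sum-replicate-zero; ∑-distrib-+; ∑-comm)
open import Data.Product using (Σ; ∃; ∃₂; _×_; _,_; proj₁; proj₂)
open import Data.Rational as ℚ using (ℚ; mkℚ; _/_; toℚᵘ; ↥_; ↧ₙ_; 0ℚ; ½; *≤*; *<*)
import Data.Rational.Properties as ℚ
open import Data.Rational.Unnormalised as ℚᵘ using (mkℚᵘ; _≃_; *≡*)
import Data.Rational.Unnormalised.Properties as ℚᵘ
open import Data.Sum using (_⊎_; inj₁; inj₂)
open import Data.Unit using (tt)
open import Data.Vec as Vec using (Vec; lookup; tabulate)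
open import Data.Vec.Functional using (updateAt)
open import Data.Vec.Functional.Properties using (updateAt-updates; updateAt-minimal)
open import Data.Vec.Properties using (lookup∘tabulate)
open import Function using (_∘_)
open import Function.Bundles using (Equivalence)
open import Function.Definitions using (Injective)
open import Relation.Binary.Construct.Closure.ReflexiveTransitive as Star using (Star; _◅_)
open import Relation.Binary.PropositionalEquality hiding ([_])
open import Relation.Nullary using (¬_; Dec; yes; no; does; contradiction)
open import Relation.Nullary.Decidable using (_×-dec_; _⊎-dec_; decidable-stable; toWitness; fromWitness; isYes≗does)
open import Relation.Unary using (Decidable)

-- Counting by indicator functions

T-not⇒¬T : ∀ {b} → T (not b) → ¬ T b
T-not⇒¬T {false} _ ()

∧⁻ : ∀ {p q} → T (p ∧ q) → T p × T q
∧⁻ = Equivalence.to T-∧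

infix 4 _⊆ᵇ_

_⊆ᵇ_ : ∀ {N} → (Fin N → Bool) → (Fin N → Bool) → Set
p ⊆ᵇ q = ∀ i → T (p i) → T (q i)

Disjointᵇ : ∀ {N} → (Fin N → Bool) → (Fin N → Bool) → Set
Disjointᵇ p q = ∀ i → ¬ (T (p i) × T (q i))

count : ∀ {N} → (Fin N → Bool) → ℕ
count {N} p = ∑[ i < N ] [ p i ]ᵇ

sum-tabulate : ∀ {N} (f : Fin N → ℕ) → ListAction.sum (List.tabulate f) ≡ sum f
sum-tabulate {zero} f = refl
sum-tabulate {suc N} f = cong (_+_ (f Fin.zero)) (sum-tabulate (λ i → f (Fin.suc i)))

Σv≡∑ : ∀ {N} (f : Fin N → ℕ) → Σv f ≡ sum f
Σv≡∑ f = trans (cong ListAction.sum (List.map-tabulate (λ i → i) f)) (sum-tabulate f)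

∑-mono-≤ : ∀ {N} {f g : Fin N → ℕ} → (∀ i → f i ≤ g i) → sum f ≤ sum g
∑-mono-≤ {zero} f≤g = z≤n
∑-mono-≤ {suc N} f≤g = +-mono-≤ (f≤g Fin.zero) (∑-mono-≤ (λ i → f≤g (Fin.suc i)))

∑-*ʳ : ∀ {N} (f : Fin N → ℕ) c → ∑[ i < N ] (f i * c) ≡ sum f * c
∑-*ʳ {zero} f c = refl
∑-*ʳ {suc N} f c = trans (cong (_+_ (f Fin.zero * c)) (∑-*ʳ (λ i → f (Fin.suc i)) c))
                         (sym (*-distribʳ-+ c (f Fin.zero) _))

count-⊤ : ∀ N → count {N} (λ _ → true) ≡ N
count-⊤ zero = refl
count-⊤ (suc N) = cong suc (count-⊤ N)

count-⁅_⁆ : ∀ {N} (c : Fin N) → count (λ i → does (i ≟ c)) ≡ 1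
count-⁅_⁆ {suc N} Fin.zero = cong suc (sum-replicate-zero N)
count-⁅ Fin.suc c ⁆ = trans (sum-cong-≗ shift) count-⁅ c ⁆
  where
  shift : ∀ i → [ does (Fin.suc i ≟ Fin.suc c) ]ᵇ ≡ [ does (i ≟ c) ]ᵇ
  shift i with i ≟ c
  ... | yes _ = refl
  ... | no _ = refl

count-split : ∀ {N} (p q : Fin N → Bool) →
  count p ≡ count (λ i → p i ∧ q i) + count (λ i → p i ∧ not (q i))
count-split p q =
  trans (sum-cong-≗ (λ i → split (p i) (q i))) (∑-distrib-+ (λ i → [ p i ∧ q i ]ᵇ) (λ i → [ p i ∧ not (q i) ]ᵇ))
  where
  split : ∀ a b → [ a ]ᵇ ≡ [ a ∧ b ]ᵇ + [ a ∧ not b ]ᵇ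
  split false b = refl
  split true true = refl
  split true false = refl

count-mono : ∀ {N} {p q : Fin N → Bool} → p ⊆ᵇ q → count p ≤ count q
count-mono {p = p} {q} p⊆q = ∑-mono-≤ (λ i → [p]≤[q] (p i) (q i) (p⊆q i))
  where
  [p]≤[q] : ∀ a b → (T a → T b) → [ a ]ᵇ ≤ [ b ]ᵇ
  [p]≤[q] false b _ = z≤n
  [p]≤[q] true true _ = ≤-refl
  [p]≤[q] true false a⇒b = ⊥-elim (a⇒b tt)

count-<⇒∃ : ∀ {N} (p q : Fin N → Bool) → count q < count p → ∃ λ i → T (p i) × ¬ T (q i)
count-<⇒∃ p q q<p with any? (λ i → T? (p i ∧ not (q i)))
... | yes (i , pq) = i , witness (p i) (q i) pq
  where
  witness : ∀ a b → T (a ∧ not b) → T a × ¬ T b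
  witness true false _ = tt , λ ()
... | no none = contradiction (count-mono (λ i pi → inside (p i) (q i) pi (λ pq → none (i , pq)))) (<⇒≱ q<p)
  where
  inside : ∀ a b → T a → ¬ T (a ∧ not b) → T b
  inside true true _ _ = tt
  inside true false _ ¬pq = ¬pq tt

count>0⇒∃ : ∀ {N} (p : Fin N → Bool) → 0 < count p → ∃ λ i → T (p i)
count>0⇒∃ {N} p pos with count-<⇒∃ p (λ _ → false) (subst (_< count p) (sym (sum-replicate-zero N)) pos)
... | i , pi , _ = i , pi

∣∣≡count : ∀ {N} (v : Vec Bool N) → ∣ v ∣ ≡ count (lookup v)
∣∣≡count Vec.[] = refl
∣∣≡count (true Vec.∷ v) = cong suc (∣∣≡count v)
∣∣≡count (false Vec.∷ v) = ∣∣≡count v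

insert : ∀ {N} → Fin N → (Fin N → Bool) → Fin N → Bool
insert c p i = does (i ≟ c) ∨ p i

count-insert : ∀ {N} (p : Fin N → Bool) {c} → ¬ T (p c) → count (insert c p) ≡ suc (count p)
count-insert p {c} ¬pc =
  trans (sum-cong-≗ split) (trans (∑-distrib-+ (λ i → [ does (i ≟ c) ]ᵇ) (λ i → [ p i ]ᵇ))
                                  (cong (_+ count p) count-⁅ c ⁆))
  where
  split : ∀ i → [ does (i ≟ c) ∨ p i ]ᵇ ≡ [ does (i ≟ c) ]ᵇ + [ p i ]ᵇ
  split i with i ≟ c
  ... | no _ = refl
  ... | yes refl with p i
  ...   | false = refl
  ...   | true = contradiction tt ¬pc

count<N : ∀ {N} (p : Fin N → Bool) {v} → ¬ T (p v) → count p < N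
count<N {N} p {v} ¬pv = begin
  suc (count p)                           ≡⟨ count-insert p {v} ¬pv ⟨
  count (insert v p)                      ≤⟨ count-mono {p = insert v p} {λ _ → true} (λ _ _ → tt) ⟩
  count {N} (λ _ → true)                  ≡⟨ count-⊤ N ⟩
  N                                       ∎
  where open ≤-Reasoning

infix 4 _∈?_ _∈ᵇ_

_∈?_ : ∀ {N} (x : Fin N) xs → Dec (x ∈ xs)
x ∈? xs = Any.any? (x ≟_) xs

-- y ∷ ys unfolds to insert y (_∈ᵇ ys) under _∈ᵇ_, so count-insert applies to it directly.
_∈ᵇ_ : ∀ {N} → Fin N → List (Fin N) → Bool
x ∈ᵇ xs = does (x ∈? xs)

∈ᵇ⇒∈ : ∀ {N} {x : Fin N} {xs} → T (x ∈ᵇ xs) → x ∈ xs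
∈ᵇ⇒∈ {x = x} {xs} = toWitness ∘ subst T (sym (isYes≗does (x ∈? xs)))

∈⇒∈ᵇ : ∀ {N} {x : Fin N} {xs} → x ∈ xs → T (x ∈ᵇ xs)
∈⇒∈ᵇ {x = x} {xs} = subst T (isYes≗does (x ∈? xs)) ∘ fromWitness

count-∈ᵇ≤length : ∀ {N} (xs : List (Fin N)) → count (_∈ᵇ xs) ≤ length xs
count-∈ᵇ≤length {N} [] = ≤-reflexive (sum-replicate-zero N)
count-∈ᵇ≤length {N} (y ∷ ys) = begin
  count (_∈ᵇ (y ∷ ys))                             ≤⟨ ∑-mono-≤ (λ i → [∨]≤[]+[] (does (i ≟ y)) (i ∈ᵇ ys)) ⟩
  ∑[ i < N ] ([ does (i ≟ y) ]ᵇ + [ i ∈ᵇ ys ]ᵇ)   ≡⟨ ∑-distrib-+ (λ i → [ does (i ≟ y) ]ᵇ) (λ i → [ i ∈ᵇ ys ]ᵇ) ⟩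
  count (λ i → does (i ≟ y)) + count (_∈ᵇ ys)     ≡⟨ cong (_+ count (_∈ᵇ ys)) count-⁅ y ⁆ ⟩
  suc (count (_∈ᵇ ys))                            ≤⟨ s≤s (count-∈ᵇ≤length ys) ⟩
  suc (length ys)                                 ∎
  where
  open ≤-Reasoning
  [∨]≤[]+[] : ∀ a b → [ a ∨ b ]ᵇ ≤ [ a ]ᵇ + [ b ]ᵇ
  [∨]≤[]+[] true b = s≤s z≤n
  [∨]≤[]+[] false b = ≤-refl

count-∈ᵇ-unique : ∀ {N} {xs : List (Fin N)} → Unique xs → count (_∈ᵇ xs) ≡ length xs
count-∈ᵇ-unique {N} {[]} _ = sum-replicate-zero N
count-∈ᵇ-unique {xs = y ∷ ys} (y∉ys ∷ unique) =
  trans (count-insert (_∈ᵇ ys) (All¬⇒¬Any y∉ys ∘ ∈ᵇ⇒∈)) (cong suc (count-∈ᵇ-unique unique))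

module _ {N : ℕ} where

  _ᵀ : Digraph N → Digraph N
  (G ᵀ) i j = G j i

  redGraph blueGraph : Digraph N → (Fin N → Fin N → Bool) → Digraph N
  redGraph adj red i j = adj i j ∧ red i j
  blueGraph adj red i j = adj i j ∧ not (red i j)

  edges : Digraph N → (Fin N → Bool) → (Fin N → Bool) → ℕ
  edges G A B = ∑[ i < N ] ∑[ j < N ] [ A i ∧ B j ∧ G i j ]ᵇ

  outdeg indeg : Digraph N → (Fin N → Bool) → Fin N → ℕ
  outdeg G Y x = count (λ y → Y y ∧ G x y)
  indeg G = outdeg (G ᵀ)

  edges-ᵀ : ∀ G A B → edges (G ᵀ) A B ≡ edges G B A
  edges-ᵀ G A B = trans (∑-comm (λ i j → [ A i ∧ B j ∧ G j i ]ᵇ))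
                        (sum-cong-≗ (λ j → sum-cong-≗ (λ i → cong [_]ᵇ (swap (A i) (B j) (G j i)))))
    where
    swap : ∀ a b g → a ∧ b ∧ g ≡ b ∧ a ∧ g
    swap true true g = refl
    swap true false g = refl
    swap false true g = refl
    swap false false g = refl

  edges-≤-red+blue : ∀ adj red {u A Y : Fin N → Bool} {n} → A ⊆ᵇ u → Y ⊆ᵇ u →
    (∀ x → T (A x) → outdeg (redGraph adj red) Y x ≤ n) →
    edges adj A Y ≤ count A * n + edges (blueGraph adj red) u u
  edges-≤-red+blue adj red {u} {A} {Y} {n} A⊆u Y⊆u few-red =
    ≤-trans (∑-mono-≤ row)
      (≤-reflexive (trans (∑-distrib-+ (λ x → [ A x ]ᵇ * n) (λ x → blueRow x))
                          (cong (_+ edges (blueGraph adj red) u u) (∑-*ʳ (λ x → [ A x ]ᵇ) n))))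
    where
    blueRow : Fin N → ℕ
    blueRow x = ∑[ y < N ] [ u x ∧ u y ∧ blueGraph adj red x y ]ᵇ
    red-or-blue : ∀ ux uy yv e r → T ux → (T yv → T uy) →
      [ yv ∧ e ]ᵇ ≤ [ yv ∧ (e ∧ r) ]ᵇ + [ ux ∧ uy ∧ e ∧ not r ]ᵇ
    red-or-blue true uy false e r _ _ = z≤n
    red-or-blue true true true false r _ _ = z≤n
    red-or-blue true true true true true _ _ = ≤-refl
    red-or-blue true true true true false _ _ = ≤-refl
    red-or-blue true false true e r _ yv⇒uy = ⊥-elim (yv⇒uy tt)
    row : ∀ x → ∑[ y < N ] [ A x ∧ Y y ∧ adj x y ]ᵇ ≤ [ A x ]ᵇ * n + blueRow x
    row x with A x in Ax
    ... | false = ≤-trans (≤-reflexive (sum-replicate-zero N)) z≤n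
    ... | true = begin
      ∑[ y < N ] [ Y y ∧ adj x y ]ᵇ
        ≤⟨ ∑-mono-≤ (λ y → red-or-blue (u x) (u y) (Y y) (adj x y) (red x y) ux (Y⊆u y)) ⟩
      ∑[ y < N ] ([ Y y ∧ redGraph adj red x y ]ᵇ + [ u x ∧ u y ∧ blueGraph adj red x y ]ᵇ)
        ≡⟨ ∑-distrib-+ (λ y → [ Y y ∧ redGraph adj red x y ]ᵇ) (λ y → [ u x ∧ u y ∧ blueGraph adj red x y ]ᵇ) ⟩
      outdeg (redGraph adj red) Y x + blueRow x
        ≤⟨ +-monoˡ-≤ (blueRow x) (≤-trans (few-red x (subst T (sym Ax) tt)) (m≤m+n n 0)) ⟩
      1 * n + blueRow x ∎
      where
      open ≤-Reasoning
      ux = A⊆u x (subst T (sym Ax) tt)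

  MinSemidegree : Digraph N → ℕ → (Fin N → Bool) → Set
  MinSemidegree G k W = ∀ w → T (W w) → k ≤ outdeg G W w × k ≤ indeg G W w

  outdeg-mono : ∀ G {Y Z} x → Y ⊆ᵇ Z → outdeg G Y x ≤ outdeg G Z x
  outdeg-mono G {Y} {Z} x Y⊆Z = count-mono (λ y → ∧-monoˡ (Y y) (Z y) (Y⊆Z y))
    where
    ∧-monoˡ : ∀ p q {r} → (T p → T q) → T (p ∧ r) → T (q ∧ r)
    ∧-monoˡ true true _ pr = pr
    ∧-monoˡ true false p⇒q _ = ⊥-elim (p⇒q tt)

-- Peeling

-- With ε = a/b: ε x m/2 ≤ ε x y ≤ x n + β ≤ ε x m/4 + ε² m²/32 ≤ ε x m/4 + ε x m/8 < ε x m/2.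
large-sparse-pair-impossible : ∀ {a b m n x y β} → 0 < a → 0 < b → 0 < m →
  a * (x * y) ≤ b * (x * n + β) → 4 * b * n ≤ a * m → 32 * b * b * β ≤ a * a * m * m →
  m ≤ 2 * y → a * m ≤ 4 * b * x → ⊥
large-sparse-pair-impossible {a} {b} {m} {n} {x} {y} {β} 0<a 0<b 0<m εxy≤ 4bn≤am β≤ m≤2y am≤4bx =
  <-irrefl refl (≤-trans 4Z>0 (+-cancelˡ-≤ (12 * Z) (4 * Z) 0 16Z≤12Z))
  where
  open ≤-Reasoning
  id₁ : ∀ a b x m → 12 * (a * b * x * m) + 4 * (a * b * x * m) ≡ 16 * (a * b * x) * m
  id₁ = solve-∀
  id₂ : ∀ a b x y → 16 * (a * b * x) * (2 * y) ≡ 32 * b * (a * (x * y))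
  id₂ = solve-∀
  id₃ : ∀ b x n β → 32 * b * (b * (x * n + β)) ≡ 8 * b * x * (4 * b * n) + 32 * b * b * β
  id₃ = solve-∀
  id₄ : ∀ a m → a * a * m * m ≡ (a * m) * (a * m)
  id₄ = solve-∀
  id₅ : ∀ a b x m → 8 * b * x * (a * m) + (a * m) * (4 * b * x) ≡ 12 * (a * b * x * m) + 0
  id₅ = solve-∀
  Z = a * b * x * m
  positive : ∀ x → a * m ≤ 4 * b * x → 0 < x
  positive zero am≤0 = contradiction (≤-trans am≤0 (≤-reflexive (*-zeroʳ (4 * b)))) (<⇒≱ (*-mono-< 0<a 0<m))
  positive (suc _) _ = z<s
  4Z>0 : 0 < 4 * Z
  4Z>0 = *-mono-< (z<s {3}) (*-mono-< (*-mono-< (*-mono-< 0<a 0<b) (positive x am≤4bx)) 0<m)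
  16Z≤12Z : 12 * Z + 4 * Z ≤ 12 * Z + 0
  16Z≤12Z = begin
    12 * Z + 4 * Z                          ≡⟨ id₁ a b x m ⟩
    16 * (a * b * x) * m                    ≤⟨ *-monoʳ-≤ (16 * (a * b * x)) m≤2y ⟩
    16 * (a * b * x) * (2 * y)              ≡⟨ id₂ a b x y ⟩
    32 * b * (a * (x * y))                  ≤⟨ *-monoʳ-≤ (32 * b) εxy≤ ⟩
    32 * b * (b * (x * n + β))              ≡⟨ id₃ b x n β ⟩
    8 * b * x * (4 * b * n) + 32 * b * b * β ≤⟨ +-mono-≤ (*-monoʳ-≤ (8 * b * x) 4bn≤am) β≤ ⟩
    8 * b * x * (a * m) + a * a * m * m     ≡⟨ cong (_+_ (8 * b * x * (a * m))) (id₄ a m) ⟩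
    8 * b * x * (a * m) + (a * m) * (a * m) ≤⟨ +-monoʳ-≤ (8 * b * x * (a * m)) (*-monoʳ-≤ (a * m) am≤4bx) ⟩
    8 * b * x * (a * m) + (a * m) * (4 * b * x) ≡⟨ id₅ a b x m ⟩
    12 * (a * b * x * m) + 0 ∎

⌈n/2⌉≤1+⌊n/2⌋ : ∀ n → ⌈ n /2⌉ ≤ suc ⌊ n /2⌋
⌈n/2⌉≤1+⌊n/2⌋ zero = z≤n
⌈n/2⌉≤1+⌊n/2⌋ (suc zero) = s≤s z≤n
⌈n/2⌉≤1+⌊n/2⌋ (suc (suc n)) = s≤s (⌈n/2⌉≤1+⌊n/2⌋ n)

2⌊n/2⌋≤n : ∀ n → 2 * ⌊ n /2⌋ ≤ n
2⌊n/2⌋≤n n = begin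
  ⌊ n /2⌋ + (⌊ n /2⌋ + 0)  ≡⟨ cong (_+_ (⌊ n /2⌋)) (+-identityʳ ⌊ n /2⌋) ⟩
  ⌊ n /2⌋ + ⌊ n /2⌋        ≤⟨ +-monoʳ-≤ ⌊ n /2⌋ (⌊n/2⌋≤⌈n/2⌉ n) ⟩
  ⌊ n /2⌋ + ⌈ n /2⌉        ≡⟨ ⌊n/2⌋+⌈n/2⌉≡n n ⟩
  n                        ∎
  where open ≤-Reasoning

-- With ε = a/b: since εm ≥ 1 and ε < 1/2, εm ≤ m - 1 ≤ 2⌊m/2⌋.
a*m≤2*b*⌊m/2⌋ : ∀ {a b m} → 2 * a < b → b ≤ a * m → a * m ≤ 2 * b * ⌊ m /2⌋
a*m≤2*b*⌊m/2⌋ {a} {b} {m} 2a<b b≤am = +-cancelʳ-≤ b (a * m) (2 * b * h) (begin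
  a * m + b                ≤⟨ +-monoʳ-≤ (a * m) b≤am ⟩
  a * m + a * m            ≡⟨ id₁ a m ⟩
  2 * a * m                ≤⟨ *-monoˡ-≤ m (≤-trans (n≤1+n (2 * a)) 2a<b) ⟩
  b * m                    ≤⟨ *-monoʳ-≤ b m≤h+1+h ⟩
  b * (h + suc h)          ≡⟨ id₂ b h ⟩
  2 * b * h + b            ∎)
  where
  open ≤-Reasoning
  id₁ : ∀ a m → a * m + a * m ≡ 2 * a * m
  id₁ = solve-∀
  id₂ : ∀ b h → b * (h + suc h) ≡ 2 * b * h + b
  id₂ = solve-∀
  h = ⌊ m /2⌋
  m≤h+1+h : m ≤ h + suc h
  m≤h+1+h = ≤-trans (≤-reflexive (sym (⌊n/2⌋+⌈n/2⌉≡n m))) (+-monoʳ-≤ h (⌈n/2⌉≤1+⌊n/2⌋ m))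

x+y≤2y : ∀ {x y} → 2 * x ≤ x + y → x + y ≤ 2 * y
x+y≤2y {x} {y} 2x≤x+y = begin
  x + y        ≤⟨ +-monoˡ-≤ y (+-cancelˡ-≤ x x y (≤-trans (≤-reflexive (cong (_+_ x) (sym (+-identityʳ x)))) 2x≤x+y)) ⟩
  y + y        ≡⟨ cong (_+_ y) (+-identityʳ y) ⟨
  2 * y        ∎
  where open ≤-Reasoning

-- The hypotheses of the theorem for ε = a/b and m = |U|, with denominators cleared; sets are
-- indicator functions, and pseudorandomness is only used for sets of size at least εm/4 ≥ σ log N.
record Hypotheses {N} (adj red : Digraph N) (u : Fin N → Bool) (n a b : ℕ) : Set where
  field
    0<a : 0 < a
    2a<b : 2 * a < b
    0<n : 0 < n
    tree-small : 4 * b * n ≤ a * count u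
    few-blue : 32 * b * b * edges (blueGraph adj red) u u ≤ a * a * count u * count u
    pseudorandom : ∀ A B → Disjointᵇ A B →
      a * count u ≤ 4 * b * count A → a * count u ≤ 4 * b * count B →
      a * (count A * count B) ≤ b * edges adj A B

  0<b : 0 < b
  0<b = ≤-trans (s≤s z≤n) 2a<b

  b≤am : b ≤ a * count u
  b≤am = ≤-trans (m≤n*m b 4) (≤-trans (m≤m*n (4 * b) n {{>-nonZero 0<n}}) tree-small)

  0<m : 0 < count u
  0<m with count u | tree-small
  ... | suc _ | _ = z<s
  ... | zero | 4bn≤0 = contradiction (≤-trans 4bn≤0 (≤-reflexive (*-zeroʳ a)))
                                     (<⇒≱ (*-mono-< (*-mono-< (z<s {3}) 0<b) 0<n))

Hypotheses-ᵀ : ∀ {N} {adj red : Digraph N} {u n a b} →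
  Hypotheses adj red u n a b → Hypotheses (adj ᵀ) (red ᵀ) u n a b
Hypotheses-ᵀ {adj = adj} {red} {u} {n} {a} {b} H = record
  { 0<a = 0<a ; 2a<b = 2a<b ; 0<n = 0<n ; tree-small = tree-small
  ; few-blue = subst (λ β → 32 * b * b * β ≤ a * a * count u * count u)
                     (sym (edges-ᵀ (blueGraph adj red) u u)) few-blue
  ; pseudorandom = λ A B A∩B am≤4bA am≤4bB →
      subst₂ (λ x y → a * x ≤ b * y) (*-comm (count B) (count A)) (sym (edges-ᵀ adj A B))
             (pseudorandom B A (λ i (Bi , Ai) → A∩B i (Ai , Bi)) am≤4bB am≤4bA)
  }
  where open Hypotheses H

module _ {N} {adj red : Digraph N} {u n a b} (H : Hypotheses adj red u n a b) where
  open Hypotheses H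

  private
    m = count u

  a≤b : a ≤ b
  a≤b = ≤-trans (m≤n+m a a) (≤-trans (≤-reflexive (cong (_+_ a) (sym (+-identityʳ a)))) (<⇒≤ 2a<b))

  sparse-out-small : ∀ {A Y} → A ⊆ᵇ u → Y ⊆ᵇ u → Disjointᵇ A Y → m ≤ 2 * count Y →
    (∀ x → T (A x) → outdeg (redGraph adj red) Y x < n) → 4 * b * count A < a * m
  sparse-out-small {A} {Y} A⊆u Y⊆u A∩Y m≤2y few-red with a * m ≤? 4 * b * count A
  ... | no am≰4bA = ≰⇒> am≰4bA
  ... | yes am≤4bA = ⊥-elim (large-sparse-pair-impossible 0<a 0<b 0<m
          (≤-trans (pseudorandom A Y A∩Y am≤4bA am≤4bY)
                   (*-monoʳ-≤ b (edges-≤-red+blue adj red A⊆u Y⊆u (λ x Ax → <⇒≤ (few-red x Ax)))))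
          tree-small few-blue m≤2y am≤4bA)
    where
    am≤4bY : a * m ≤ 4 * b * count Y
    am≤4bY = begin
      a * m               ≤⟨ *-monoˡ-≤ m a≤b ⟩
      b * m               ≤⟨ *-monoʳ-≤ b m≤2y ⟩
      b * (2 * count Y)   ≤⟨ *-monoʳ-≤ b (*-monoˡ-≤ (count Y) (m≤m+n 2 2)) ⟩
      b * (4 * count Y)   ≡⟨ trans (sym (*-assoc b 4 (count Y))) (cong (_* count Y) (*-comm b 4)) ⟩
      4 * b * count Y     ∎
      where open ≤-Reasoning

module _ {N} {adj red : Digraph N} {u n a b} (H : Hypotheses adj red u n a b) where
  open Hypotheses H

  private
    m = count u
    R = redGraph adj red

  -- In-degrees are out-degrees in the transposed graph, which satisfies the same hypotheses.
  sparse-in-small : ∀ {A Y} → A ⊆ᵇ u → Y ⊆ᵇ u → Disjointᵇ A Y → m ≤ 2 * count Y →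
    (∀ x → T (A x) → indeg R Y x < n) → 4 * b * count A < a * m
  sparse-in-small = sparse-out-small (Hypotheses-ᵀ H)

  rest : (Fin N → Bool) → Fin N → Bool
  rest X i = u i ∧ not (X i)

  LowDegree : (Fin N → Bool) → Fin N → Set
  LowDegree Y x = outdeg R Y x < n ⊎ indeg R Y x < n

  Peeled : (Fin N → Bool) → Set
  Peeled X = X ⊆ᵇ u × (∀ x → T (X x) → LowDegree (rest X) x)

  rest⊆u : ∀ X → rest X ⊆ᵇ u
  rest⊆u X i = proj₁ ∘ ∧⁻

  disjoint-rest : ∀ {A X} → A ⊆ᵇ X → Disjointᵇ A (rest X)
  disjoint-rest {A} {X} A⊆X i (Ai , restXi) =
    T-not⇒¬T (proj₂ (∧⁻ {u i} restXi)) (A⊆X i Ai)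

  count-rest : ∀ {X} → X ⊆ᵇ u → count X + count (rest X) ≡ m
  count-rest {X} X⊆u =
    trans (cong (_+ count (rest X)) (sum-cong-≗ (λ i → cong [_]ᵇ (absorb (u i) (X i) (X⊆u i)))))
          (sym (count-split u X))
    where
    absorb : ∀ p q → (T q → T p) → q ≡ p ∧ q
    absorb true q _ = refl
    absorb false false _ = refl
    absorb false true q⇒p = ⊥-elim (q⇒p tt)

  peeled-small : ∀ {X} → Peeled X → m ≤ 2 * count (rest X) → 2 * b * count X < a * m
  peeled-small {X} (X⊆u , low) m≤2y = *-cancelˡ-< 2 (2 * b * count X) (a * m) (begin-strict
    2 * (2 * b * count X)                ≡⟨ double b (count X) ⟩
    4 * b * count X                      ≡⟨ cong (4 * b *_) (count-split X out?) ⟩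
    4 * b * (count Xo + count Xi)        ≡⟨ *-distribˡ-+ (4 * b) (count Xo) (count Xi) ⟩
    4 * b * count Xo + 4 * b * count Xi  <⟨ +-mono-< Xo-small Xi-small ⟩
    a * m + a * m                        ≡⟨ cong (_+_ (a * m)) (+-identityʳ (a * m)) ⟨
    2 * (a * m)                          ∎)
    where
    open ≤-Reasoning
    double : ∀ b x → 2 * (2 * b * x) ≡ 4 * b * x
    double = solve-∀
    Y = rest X
    out? : Fin N → Bool
    out? x = outdeg R Y x <ᵇ n
    Xo Xi : Fin N → Bool
    Xo x = X x ∧ out? x
    Xi x = X x ∧ not (out? x)
    Xo⊆X : Xo ⊆ᵇ X
    Xo⊆X x = proj₁ ∘ ∧⁻
    Xi⊆X : Xi ⊆ᵇ X
    Xi⊆X x = proj₁ ∘ ∧⁻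
    Xo⊆u : Xo ⊆ᵇ u
    Xo⊆u x = X⊆u x ∘ Xo⊆X x
    Xi⊆u : Xi ⊆ᵇ u
    Xi⊆u x = X⊆u x ∘ Xi⊆X x
    Xo-low : ∀ x → T (Xo x) → outdeg R Y x < n
    Xo-low x = <ᵇ⇒< (outdeg R Y x) n ∘ proj₂ ∘ ∧⁻
    Xi-low : ∀ x → T (Xi x) → indeg R Y x < n
    Xi-low x Xix with ∧⁻ Xix
    ... | Xx , ¬out with low x Xx
    ...   | inj₁ out = contradiction (<⇒<ᵇ out) (T-not⇒¬T ¬out)
    ...   | inj₂ in< = in<
    Xo-small : 4 * b * count Xo < a * m
    Xo-small = sparse-out-small H Xo⊆u (rest⊆u X) (disjoint-rest Xo⊆X) m≤2y Xo-low
    Xi-small : 4 * b * count Xi < a * m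
    Xi-small = sparse-in-small Xi⊆u (rest⊆u X) (disjoint-rest Xi⊆X) m≤2y Xi-low

  rest-anti : ∀ {X Z} → X ⊆ᵇ Z → rest Z ⊆ᵇ rest X
  rest-anti {X} {Z} X⊆Z i = shrink (u i) (X i) (Z i) (X⊆Z i)
    where
    shrink : ∀ p x z → (T x → T z) → T (p ∧ not z) → T (p ∧ not x)
    shrink true false z _ _ = tt
    shrink true true true _ ()
    shrink true true false x⇒z _ = x⇒z tt

  LowDegree-anti : ∀ {Y Z} x → Y ⊆ᵇ Z → LowDegree Z x → LowDegree Y x
  LowDegree-anti x Y⊆Z (inj₁ out<n) = inj₁ (≤-<-trans (outdeg-mono R x Y⊆Z) out<n)
  LowDegree-anti x Y⊆Z (inj₂ in<n) = inj₂ (≤-<-trans (outdeg-mono (R ᵀ) x Y⊆Z) in<n)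

  Peeled-insert : ∀ {X w} → Peeled X → T (rest X w) → LowDegree (rest X) w → Peeled (insert w X)
  Peeled-insert {X} {w} (X⊆u , low) restXw low-w = insert⊆u , insert-low
    where
    X⊆insert : X ⊆ᵇ insert w X
    X⊆insert i = Equivalence.from T-∨ ∘ inj₂
    insert⊆u : insert w X ⊆ᵇ u
    insert⊆u i with i ≟ w
    ... | yes refl = λ _ → proj₁ (∧⁻ restXw)
    ... | no _ = X⊆u i
    insert-low : ∀ x → T (insert w X x) → LowDegree (rest (insert w X)) x
    insert-low x with x ≟ w
    ... | yes refl = λ _ → LowDegree-anti x (rest-anti X⊆insert) low-w
    ... | no _ = LowDegree-anti x (rest-anti X⊆insert) ∘ low x

  m≤2*rest : ∀ {X} → X ⊆ᵇ u → 2 * count X ≤ m → m ≤ 2 * count (rest X)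
  m≤2*rest {X} X⊆u 2x≤m =
    subst (λ m → m ≤ 2 * count (rest X)) (count-rest X⊆u)
          (x+y≤2y {count X} (subst (2 * count X ≤_) (sym (count-rest X⊆u)) 2x≤m))

  private
    h = ⌊ m /2⌋

  peel : ∀ f X → Peeled X → count X + f ≡ h → ∃ λ W → (∃ λ w → T (W w)) × MinSemidegree R n W
  peel zero X P@(X⊆u , _) |X|≡h = contradiction (peeled-small P (m≤2*rest X⊆u 2|X|≤m)) (≤⇒≯ am≤2b|X|)
    where
    |X|≡h′ : count X ≡ h
    |X|≡h′ = trans (sym (+-identityʳ (count X))) |X|≡h
    2|X|≤m : 2 * count X ≤ m
    2|X|≤m = subst (λ x → 2 * x ≤ m) (sym |X|≡h′) (2⌊n/2⌋≤n m)
    am≤2b|X| : a * m ≤ 2 * b * count X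
    am≤2b|X| = subst (λ x → a * m ≤ 2 * b * x) (sym |X|≡h′) (a*m≤2*b*⌊m/2⌋ {a} {b} {m} 2a<b b≤am)
  peel (suc f) X P@(X⊆u , _) |X|+f≡h with any? (λ w → T? (rest X w) ×-dec low? w)
    where
    low? : ∀ w → Dec (LowDegree (rest X) w)
    low? w = (outdeg R (rest X) w <? n) ⊎-dec (indeg R (rest X) w <? n)
  ... | yes (w , restXw , low-w) =
    peel f (insert w X) (Peeled-insert P restXw low-w)
      (trans (cong (_+ f) (count-insert X {w} (T-not⇒¬T (proj₂ (∧⁻ {u w} restXw)))))
             (trans (sym (+-suc (count X) f)) |X|+f≡h))
  ... | no none = rest X , count>0⇒∃ (rest X) rest≢∅ , λ w restXw →
    ≮⇒≥ (λ out<n → none (w , restXw , inj₁ out<n)) , ≮⇒≥ (λ in<n → none (w , restXw , inj₂ in<n))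
    where
    2|X|≤m : 2 * count X ≤ m
    2|X|≤m = ≤-trans (*-monoʳ-≤ 2 (≤-trans (m≤m+n (count X) (suc f)) (≤-reflexive |X|+f≡h))) (2⌊n/2⌋≤n m)
    rest≢∅ : 0 < count (rest X)
    rest≢∅ with count (rest X) | m≤2*rest X⊆u 2|X|≤m
    ... | zero | m≤0 = contradiction m≤0 (<⇒≱ 0<m)
    ... | suc _ | _ = z<s

  dense-core : ∃ λ W → (∃ λ w → T (W w)) × MinSemidegree R n W
  dense-core = peel h (λ _ → false) ((λ _ ()) , (λ _ ())) (cong (_+ h) (sum-replicate-zero N))

-- Embedding oriented trees

Star-cross : ∀ {A : Set} {R : A → A → Set} {P : A → Set} → Decidable P → ∀ {x y} → Star R x y → P x → ¬ P y →
  ∃₂ λ u v → P u × ¬ P v × R u v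
Star-cross P? Star.ε Px ¬Py = contradiction Px ¬Py
Star-cross P? {x} (_◅_ {j = z} Rxz z⋆y) Px ¬Py with P? z
... | yes Pz = Star-cross P? z⋆y Pz ¬Py
... | no ¬Pz = x , z , Px , ¬Pz , Rxz

Linked-∷ʳ : ∀ {A : Set} {R : A → A → Set} xs {x y} → Linked R (xs ∷ʳ x) → R x y → Linked R (xs ∷ʳ x ∷ʳ y)
Linked-∷ʳ [] [-] Rxy = Rxy ∷ [-]
Linked-∷ʳ (z ∷ []) (Rzx ∷ Rxs) Rxy = Rzx ∷ Linked-∷ʳ [] Rxs Rxy
Linked-∷ʳ (z ∷ z′ ∷ zs) (Rzz′ ∷ Rxs) Rxy = Rzz′ ∷ Linked-∷ʳ (z′ ∷ zs) Rxs Rxy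

module _ {n} (Tr : Digraph n) where

  und-sym : ∀ {i j} → und Tr i j → und Tr j i
  und-sym {i} {j} = subst T (∨-comm (Tr i j) (Tr j i))

  record Rooted (r : Fin n) (L : List (Fin n)) : Set where
    field
      depth : Fin n → ℕ
      parent : Fin n → Fin n
      depth-zero : ∀ {x} → x ∈ L → depth x ≡ 0 → x ≡ r
      parent-step : ∀ {x k} → x ∈ L → depth x ≡ suc k →
                    parent x ∈ L × depth (parent x) ≡ k × und Tr x (parent x)

  module _ {r L} (R : Rooted r L) where
    open Rooted R

    record Bridge (a b : Fin n) : Set where
      field
        inner : List (Fin n)
        inner≢[] : 1 ≤ length inner
        unique : Unique (a ∷ inner ∷ʳ b)
        linked : Linked (und Tr) (a ∷ inner ∷ʳ b)
        deep : ∀ {x} → x ∈ inner → x ∈ L → depth a ≤ depth x × depth b ≤ depth x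

    Bridge-close : ∀ {a b} → Bridge a b → und Tr b a → HasCycle Tr
    Bridge-close {a} {b} B ba = a , inner ∷ʳ b , unique , length≥2 , Linked-∷ʳ (a ∷ inner) linked ba
      where
      open Bridge B
      length≥2 : 2 ≤ length (inner ∷ʳ b)
      length≥2 = ≤-trans (+-monoˡ-≤ 1 inner≢[]) (≤-reflexive (sym (length-++ inner)))

    climb-left : ∀ {a b k} → Bridge a b → a ∈ L → depth a ≡ suc k → parent a ≢ b → depth b ≤ depth a →
      Bridge (parent a) b
    climb-left {a} {b} {k} B a∈L da≡1+k pa≢b db≤da = record
      { inner = a ∷ inner
      ; inner≢[] = s≤s z≤n
      ; unique = ¬Any⇒All¬ (a ∷ inner ∷ʳ b) pa∉ ∷ unique
      ; linked = und-sym pa-a ∷ linked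
      ; deep = λ { (here refl) _ → dpa≤da , db≤da
                 ; (there x∈inner) x∈L → ≤-trans dpa≤da (proj₁ (deep x∈inner x∈L)) , proj₂ (deep x∈inner x∈L) }
      }
      where
      open Bridge B
      pa∈L = proj₁ (parent-step a∈L da≡1+k)
      dpa≡k = proj₁ (proj₂ (parent-step a∈L da≡1+k))
      pa-a = proj₂ (proj₂ (parent-step a∈L da≡1+k))
      dpa≤da : depth (parent a) ≤ depth a
      dpa≤da = subst₂ _≤_ (sym dpa≡k) (sym da≡1+k) (n≤1+n k)
      pa∉ : parent a ∉ a ∷ inner ∷ʳ b
      pa∉ (here pa≡a) = 1+n≢n (trans (sym da≡1+k) (trans (cong depth (sym pa≡a)) dpa≡k))
      pa∉ (there pa∈) with ∈-++⁻ inner pa∈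
      ... | inj₁ pa∈inner = 1+n≰n (subst₂ _≤_ da≡1+k dpa≡k (proj₁ (deep pa∈inner pa∈L)))
      ... | inj₂ (here pa≡b) = pa≢b pa≡b

    climb-right : ∀ {a b k} → Bridge a b → b ∈ L → depth b ≡ suc k → parent b ≢ a → depth a ≤ depth b →
      Bridge a (parent b)
    climb-right {a} {b} {k} B b∈L db≡1+k pb≢a da≤db = record
      { inner = inner ∷ʳ b
      ; inner≢[] = ≤-trans inner≢[] (≤-trans (m≤m+n (length inner) 1) (≤-reflexive (sym (length-++ inner))))
      ; unique = Unique.++⁺ unique ([] ∷ []) (λ { (pb∈ , here refl) → pb∉ pb∈ })
      ; linked = Linked-∷ʳ (a ∷ inner) linked b-pb
      ; deep = λ x∈ x∈L → deep′ (∈-++⁻ inner x∈) x∈L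
      }
      where
      open Bridge B
      pb∈L = proj₁ (parent-step b∈L db≡1+k)
      dpb≡k = proj₁ (proj₂ (parent-step b∈L db≡1+k))
      b-pb = proj₂ (proj₂ (parent-step b∈L db≡1+k))
      dpb≤db : depth (parent b) ≤ depth b
      dpb≤db = subst₂ _≤_ (sym dpb≡k) (sym db≡1+k) (n≤1+n k)
      pb∉ : parent b ∉ a ∷ inner ∷ʳ b
      pb∉ (here pb≡a) = pb≢a pb≡a
      pb∉ (there pb∈) with ∈-++⁻ inner pb∈
      ... | inj₁ pb∈inner = 1+n≰n (subst₂ _≤_ db≡1+k dpb≡k (proj₂ (deep pb∈inner pb∈L)))
      ... | inj₂ (here pb≡b) = 1+n≢n (trans (sym db≡1+k) (trans (cong depth (sym pb≡b)) dpb≡k))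
      deep′ : ∀ {x} → x ∈ inner ⊎ x ∈ [ b ] → x ∈ L → depth a ≤ depth x × depth (parent b) ≤ depth x
      deep′ (inj₁ x∈inner) x∈L = proj₁ (deep x∈inner x∈L) , ≤-trans dpb≤db (proj₂ (deep x∈inner x∈L))
      deep′ (inj₂ (here refl)) _ = da≤db , dpb≤db

    -- Replacing the deeper end by its parent keeps the path simple, as the parent is shallower than
    -- every interior vertex in L; the depths decrease until the two ends are adjacent.
    Bridge⇒cycle : ∀ f {a b} → depth a + depth b ≤ f → a ∈ L → b ∈ L → a ≢ b → Bridge a b →
      HasCycle Tr
    Bridge⇒cycle zero {a} {b} d≤0 a∈L b∈L a≢b B =
      contradiction (trans (depth-zero a∈L (n≤0⇒n≡0 (≤-trans (m≤m+n (depth a) (depth b)) d≤0)))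
                       (sym (depth-zero b∈L (n≤0⇒n≡0 (≤-trans (m≤n+m (depth b) (depth a)) d≤0))))) a≢b
    Bridge⇒cycle (suc f) {a} {b} d≤1+f a∈L b∈L a≢b B with ≤-total (depth b) (depth a)
    ... | inj₁ db≤da with depth a in da
    ...   | zero = contradiction (trans (depth-zero a∈L da) (sym (depth-zero b∈L (n≤0⇒n≡0 db≤da)))) a≢b
    ...   | suc k with parent-step a∈L da | parent a ≟ b
    ...     | _ , _ , a-pa | yes pa≡b = Bridge-close B (subst (λ x → und Tr x a) pa≡b (und-sym a-pa))
    ...     | pa∈L , dpa≡k , _ | no pa≢b =
      Bridge⇒cycle f (subst (λ d → d + depth b ≤ f) (sym dpa≡k) (≤-pred d≤1+f)) pa∈L b∈L pa≢b
        (climb-left B a∈L da pa≢b (subst (depth b ≤_) (sym da) db≤da))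
    Bridge⇒cycle (suc f) {a} {b} d≤1+f a∈L b∈L a≢b B | inj₂ da≤db with depth b in db
    ...   | zero = contradiction (trans (depth-zero a∈L (n≤0⇒n≡0 da≤db)) (sym (depth-zero b∈L db))) a≢b
    ...   | suc k with parent-step b∈L db | parent b ≟ a
    ...     | _ , _ , b-pb | yes pb≡a = Bridge-close B (subst (und Tr b) pb≡a b-pb)
    ...     | pb∈L , dpb≡k , _ | no pb≢a =
      Bridge⇒cycle f (subst (λ d → depth a + d ≤ f) (sym dpb≡k) (≤-pred (subst (_≤ suc f) (+-suc (depth a) k) d≤1+f)))
        a∈L pb∈L (λ a≡pb → pb≢a (sym a≡pb)) (climb-right B b∈L db pb≢a (subst (depth a ≤_) (sym db) da≤db))

    attachment-unique : ¬ HasCycle Tr → ∀ {v u₁ u₂} → v ∉ L → u₁ ∈ L → u₂ ∈ L →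
      und Tr u₁ v → und Tr u₂ v → u₁ ≡ u₂
    attachment-unique acyclic {v} {u₁} {u₂} v∉L u₁∈L u₂∈L u₁v u₂v with u₁ ≟ u₂
    ... | yes u₁≡u₂ = u₁≡u₂
    ... | no u₁≢u₂ = contradiction (Bridge⇒cycle _ ≤-refl u₁∈L u₂∈L u₁≢u₂ u₁-v-u₂) acyclic
      where
      ∉L : ∀ {x} → x ∈ L → x ≢ v
      ∉L x∈L refl = v∉L x∈L
      u₁-v-u₂ : Bridge u₁ u₂
      u₁-v-u₂ = record
        { inner = [ v ]
        ; inner≢[] = s≤s z≤n
        ; unique = (∉L u₁∈L ∷ u₁≢u₂ ∷ []) ∷ ((λ v≡u₂ → ∉L u₂∈L (sym v≡u₂)) ∷ []) ∷ [] ∷ []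
        ; linked = u₁v ∷ und-sym u₂v ∷ [-]
        ; deep = λ { (here refl) v∈L → contradiction v∈L v∉L }
        }

  Rooted-extend : ∀ {r L u v} → Rooted r L → u ∈ L → v ∉ L → und Tr u v → Rooted r (v ∷ L)
  Rooted-extend {r} {L} {u} {v} R u∈L v∉L uv = record
    { depth = depth′ ; parent = parent′ ; depth-zero = depth-zero′ ; parent-step = parent-step′ }
    where
    open Rooted R
    depth′ = updateAt depth v (λ _ → suc (depth u))
    parent′ = updateAt parent v (λ _ → u)
    ∉L : ∀ {x} → x ∈ L → x ≢ v
    ∉L x∈L refl = v∉L x∈L
    depth-zero′ : ∀ {x} → x ∈ v ∷ L → depth′ x ≡ 0 → x ≡ r
    depth-zero′ (here refl) d≡0 = contradiction (trans (sym (updateAt-updates v depth)) d≡0) 1+n≢0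
    depth-zero′ (there x∈L) d≡0 = depth-zero x∈L (trans (sym (updateAt-minimal _ v depth (∉L x∈L))) d≡0)
    parent-step′ : ∀ {x k} → x ∈ v ∷ L → depth′ x ≡ suc k →
                   parent′ x ∈ v ∷ L × depth′ (parent′ x) ≡ k × und Tr x (parent′ x)
    parent-step′ (here refl) d≡1+k =
      subst (_∈ v ∷ L) (sym pv≡u) (there u∈L) ,
      trans (cong depth′ pv≡u) (trans (updateAt-minimal u v depth (∉L u∈L))
                                      (suc-injective (trans (sym (updateAt-updates v depth)) d≡1+k))) ,
      subst (und Tr v) (sym pv≡u) (und-sym uv)
      where
      pv≡u : parent′ v ≡ u
      pv≡u = updateAt-updates v parent
    parent-step′ {x} (there x∈L) d≡1+k with parent-step x∈L (trans (sym (updateAt-minimal x v depth (∉L x∈L))) d≡1+k)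
    ... | px∈L , dpx≡k , x-px =
      subst (_∈ v ∷ L) (sym px′≡px) (there px∈L) ,
      trans (cong depth′ px′≡px) (trans (updateAt-minimal (parent x) v depth (∉L px∈L)) dpx≡k) ,
      subst (und Tr x) (sym px′≡px) x-px
      where
      px′≡px : parent′ x ≡ parent x
      px′≡px = updateAt-minimal x v parent (∉L x∈L)

Embeds : ∀ {n N} → Digraph n → Digraph N → Set
Embeds {n} {N} Tr G =
  Σ (Fin n → Fin N) λ φ → Injective _≡_ _≡_ φ × (∀ i j → T (Tr i j) → T (G (φ i) (φ j)))

outneighbour-∉ : ∀ {N} (G : Digraph N) (W : Fin N → Bool) x (xs : List (Fin N)) →
  length xs < outdeg G W x → ∃ λ w → T (W w) × T (G x w) × w ∉ xs
outneighbour-∉ G W x xs |xs|<deg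
  with count-<⇒∃ (λ w → W w ∧ G x w) (_∈ᵇ xs) (≤-<-trans (count-∈ᵇ≤length xs) |xs|<deg)
... | w , Ww∧Gxw , w∉xs = w , proj₁ (∧⁻ Ww∧Gxw) , proj₂ (∧⁻ Ww∧Gxw) , w∉xs ∘ ∈⇒∈ᵇ

module _ {N n} (G : Digraph N) (W : Fin N → Bool) (Tr : Digraph n) where

  record PartialEmbedding (L : List (Fin n)) : Set where
    field
      φ : Fin n → Fin N
      into-W : ∀ {i} → i ∈ L → T (W (φ i))
      injective : ∀ {i j} → i ∈ L → j ∈ L → φ i ≡ φ j → i ≡ j
      homomorphic : ∀ {i j} → i ∈ L → j ∈ L → T (Tr i j) → T (G (φ i) (φ j))

  PartialEmbedding-extend : ∀ {L u v} (P : PartialEmbedding L) → let open PartialEmbedding P in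
    (∀ i → ¬ T (Tr i i)) → u ∈ L → v ∉ L → (∀ {j} → j ∈ L → und Tr j v → j ≡ u) →
    ∀ {w} → T (W w) → w ∉ map φ L → (T (Tr u v) → T (G (φ u) w)) → (T (Tr v u) → T (G w (φ u))) →
    PartialEmbedding (v ∷ L)
  PartialEmbedding-extend {L} {u} {v} P loopless u∈L v∉L only-u {w} Ww w∉φL u→v v→u = record
    { φ = φ′ ; into-W = into-W′ ; injective = injective′ ; homomorphic = homomorphic′ }
    where
    open PartialEmbedding P
    φ′ = updateAt φ v (λ _ → w)
    φ′v≡w : φ′ v ≡ w
    φ′v≡w = updateAt-updates v φ
    φ′≡φ : ∀ {i} → i ∈ L → φ′ i ≡ φ i
    φ′≡φ i∈L = updateAt-minimal _ v φ (λ { refl → v∉L i∈L })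
    into-W′ : ∀ {i} → i ∈ v ∷ L → T (W (φ′ i))
    into-W′ (here refl) = subst (T ∘ W) (sym φ′v≡w) Ww
    into-W′ (there i∈L) = subst (T ∘ W) (sym (φ′≡φ i∈L)) (into-W i∈L)
    w≢φ : ∀ {j} → j ∈ L → w ≢ φ j
    w≢φ j∈L w≡φj = w∉φL (subst (_∈ map φ L) (sym w≡φj) (∈-map⁺ φ j∈L))
    injective′ : ∀ {i j} → i ∈ v ∷ L → j ∈ v ∷ L → φ′ i ≡ φ′ j → i ≡ j
    injective′ (here refl) (here refl) _ = refl
    injective′ (here refl) (there j∈L) eq = contradiction (trans (sym φ′v≡w) (trans eq (φ′≡φ j∈L))) (w≢φ j∈L)
    injective′ (there i∈L) (here refl) eq = contradiction (trans (sym φ′v≡w) (trans (sym eq) (φ′≡φ i∈L))) (w≢φ i∈L)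
    injective′ (there i∈L) (there j∈L) eq = injective i∈L j∈L (trans (sym (φ′≡φ i∈L)) (trans eq (φ′≡φ j∈L)))
    homomorphic′ : ∀ {i j} → i ∈ v ∷ L → j ∈ v ∷ L → T (Tr i j) → T (G (φ′ i) (φ′ j))
    homomorphic′ (here refl) (here refl) Trvv = contradiction Trvv (loopless v)
    homomorphic′ (here refl) (there j∈L) Trvj with only-u j∈L (Equivalence.from T-∨ (inj₂ Trvj))
    ... | refl = subst₂ (λ x y → T (G x y)) (sym φ′v≡w) (sym (φ′≡φ j∈L)) (v→u Trvj)
    homomorphic′ (there i∈L) (here refl) Triv with only-u i∈L (Equivalence.from T-∨ (inj₁ Triv))
    ... | refl = subst₂ (λ x y → T (G x y)) (sym (φ′≡φ i∈L)) (sym φ′v≡w) (u→v Triv)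
    homomorphic′ (there i∈L) (there j∈L) Trij =
      subst₂ (λ x y → T (G x y)) (sym (φ′≡φ i∈L)) (sym (φ′≡φ j∈L)) (homomorphic i∈L j∈L Trij)

  module _ (tree : IsOrientedTree Tr) (min-degree : MinSemidegree G n W) (r : Fin n) where
    private
      oriented = proj₁ tree
      connected = proj₁ (proj₂ tree)
      acyclic = proj₂ (proj₂ tree)

    record Stage : Set where
      field
        L : List (Fin n)
        distinct : Unique L
        r∈L : r ∈ L
        rooted : Rooted Tr r L
        embedding : PartialEmbedding L

    |L|<n : ∀ {v} (s : Stage) → v ∉ Stage.L s → length (Stage.L s) < n
    |L|<n s v∉L = subst (_< n) (count-∈ᵇ-unique distinct) (count<N (_∈ᵇ L) (v∉L ∘ ∈ᵇ⇒∈))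
      where open Stage s

    free-neighbour : ∀ {L u v} (P : PartialEmbedding L) → let open PartialEmbedding P in
      length L < n → u ∈ L → ∃ λ w → T (W w) × w ∉ map φ L ×
        (T (Tr u v) → T (G (φ u) w)) × (T (Tr v u) → T (G w (φ u)))
    free-neighbour {L} {u} {v} P |L|<n u∈L = by-direction (T? (Tr u v))
      where
      open PartialEmbedding P
      |φL|<n : length (map φ L) < n
      |φL|<n = subst (_< n) (sym (length-map φ L)) |L|<n
      by-direction : Dec (T (Tr u v)) → ∃ λ w → T (W w) × w ∉ map φ L ×
        (T (Tr u v) → T (G (φ u) w)) × (T (Tr v u) → T (G w (φ u)))
      by-direction (yes u→v) =
        let w , Ww , φu→w , w∉ = outneighbour-∉ G W (φ u) (map φ L)
                                   (<-≤-trans |φL|<n (proj₁ (min-degree (φ u) (into-W u∈L))))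
        in w , Ww , w∉ , (λ _ → φu→w) , (λ v→u → contradiction (u→v , v→u) (proj₁ (oriented u v)))
      by-direction (no ¬u→v) =
        let w , Ww , w→φu , w∉ = outneighbour-∉ (G ᵀ) W (φ u) (map φ L)
                                   (<-≤-trans |φL|<n (proj₂ (min-degree (φ u) (into-W u∈L))))
        in w , Ww , w∉ , (λ u→v → contradiction u→v ¬u→v) , (λ _ → w→φu)

    Stage-extend : ∀ {v₀} (s : Stage) → v₀ ∉ Stage.L s →
      Σ Stage λ s′ → length (Stage.L s′) ≡ suc (length (Stage.L s))
    Stage-extend {v₀} s v₀∉L with Star-cross (_∈? Stage.L s) (connected r v₀) (Stage.r∈L s) v₀∉L
    ... | u , v , u∈L , v∉L , uv with free-neighbour {v = v} (Stage.embedding s) (|L|<n s v₀∉L) u∈L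
    ...   | w , Ww , w∉ , u→v⇒ , v→u⇒ = record
      { L = v ∷ L
      ; distinct = ¬Any⇒All¬ L v∉L ∷ distinct
      ; r∈L = there r∈L
      ; rooted = Rooted-extend Tr rooted u∈L v∉L uv
      ; embedding = PartialEmbedding-extend embedding (λ i → proj₂ (oriented i i)) u∈L v∉L
          (λ j∈L jv → attachment-unique Tr rooted acyclic v∉L j∈L u∈L jv uv) Ww w∉ u→v⇒ v→u⇒
      } , refl
      where open Stage s

    Stage-complete : (s : Stage) → (∀ v → v ∈ Stage.L s) → Embeds Tr G
    Stage-complete s all∈L =
      φ , (λ {i} {j} → injective (all∈L i) (all∈L j)) , (λ i j → homomorphic (all∈L i) (all∈L j))
      where open PartialEmbedding (Stage.embedding s)

    grow : ∀ f (s : Stage) → n ≤ f + length (Stage.L s) → Embeds Tr G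
    grow zero s n≤|L| = Stage-complete s λ v →
      decidable-stable (v ∈? Stage.L s) (λ v∉L → <⇒≱ (|L|<n s v∉L) n≤|L|)
    grow (suc f) s n≤1+f+|L| with all? (_∈? Stage.L s)
    ... | yes all∈L = Stage-complete s all∈L
    ... | no ¬all∈L =
      let v₀ , v₀∉L = ¬∀⟶∃¬ n _ (_∈? Stage.L s) ¬all∈L
          s′ , |L′|≡1+|L| = Stage-extend s v₀∉L
      in grow f s′ (subst (λ k → n ≤ f + k) (sym |L′|≡1+|L|) (subst (n ≤_) (sym (+-suc f _)) n≤1+f+|L|))

    embed-tree : ∀ {w₀} → T (W w₀) → Embeds Tr G
    embed-tree {w₀} Ww₀ = grow n initial (m≤m+n n 1)
      where
      initial : Stage
      initial = record
        { L = [ r ]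
        ; distinct = [] ∷ []
        ; r∈L = here refl
        ; rooted = record
          { depth = λ _ → 0 ; parent = λ x → x
          ; depth-zero = λ { (here refl) _ → refl }
          ; parent-step = λ { (here refl) () }
          }
        ; embedding = record
          { φ = λ _ → w₀
          ; into-W = λ _ → Ww₀
          ; injective = λ { (here refl) (here refl) _ → refl }
          ; homomorphic = λ { (here refl) (here refl) Trrr → contradiction Trrr (proj₂ (oriented r r)) }
          }
        }

-- Clearing denominators

+*+≤+*+⇒*≤* : ∀ m n o p → + m ℤ.* + n ℤ.≤ + o ℤ.* + p → m * n ≤ o * p
+*+≤+*+⇒*≤* m n o p = ℤ.drop‿+≤+ ∘ subst₂ ℤ._≤_ (sym (ℤ.pos-* m n)) (sym (ℤ.pos-* o p))

infix 4 _≈_/_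

_≈_/_ : ℚ → ℕ → (q : ℕ) .{{_ : NonZero q}} → Set
x ≈ p / q = toℚᵘ x ≃ (+ p) ℚᵘ./ q

≈-ℕ→ℚ : ∀ m → ℕ→ℚ m ≈ m / 1
≈-ℕ→ℚ m = subst (λ x → toℚᵘ x ≃ mkℚᵘ (+ m) 0) (sym (ℚ.normalize-coprime {m} {0} coprime)) ℚᵘ.≃-refl
  where
  coprime : Coprime m 1
  coprime (_ , d∣1) = ∣1⇒≡1 d∣1

≈-1/ : ∀ d → (+ 1 ℚ./ suc d) ≈ 1 / suc d
≈-1/ d = subst (λ x → toℚᵘ x ≃ mkℚᵘ (+ 1) d) (sym (ℚ.normalize-coprime {1} {d} coprime)) ℚᵘ.≃-refl
  where
  coprime : Coprime 1 (suc d)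
  coprime (d∣1 , _) = ∣1⇒≡1 d∣1

≈-* : ∀ x y {a b c e} .{{_ : NonZero b}} .{{_ : NonZero e}} →
  x ≈ a / b → y ≈ c / e → (x ℚ.* y ≈ a * c / b * e) {{m*n≢0 b e}}
≈-* x y {a} {b@(suc _)} {c} {e@(suc _)} x≈ y≈ =
  ℚᵘ.≃-trans (ℚ.toℚᵘ-homo-* x y)
    (ℚᵘ.≃-trans (ℚᵘ.*-cong x≈ y≈) (*≡* (cong (ℤ._* + (b * e)) (sym (ℤ.pos-* a c)))))

≈-≤ : ∀ {x y a b c e} .{{_ : NonZero b}} .{{_ : NonZero e}} →
  x ≈ a / b → y ≈ c / e → x ℚ.≤ y → a * e ≤ c * b
≈-≤ {a = a} {suc b} {c} {suc e} x≈ y≈ x≤y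
  with ℚᵘ.≤-respʳ-≃ y≈ (ℚᵘ.≤-respˡ-≃ x≈ (ℚ.toℚᵘ-mono-≤ x≤y))
... | ℚᵘ.*≤* ae≤cb = +*+≤+*+⇒*≤* a (suc e) c (suc b) ae≤cb

≈-≤⁻ : ∀ {x y a b c e} .{{_ : NonZero b}} .{{_ : NonZero e}} →
  x ≈ a / b → y ≈ c / e → a * e ≤ c * b → x ℚ.≤ y
≈-≤⁻ {a = a} {suc b} {c} {suc e} x≈ y≈ ae≤cb =
  ℚ.toℚᵘ-cancel-≤ (ℚᵘ.≤-respʳ-≃ (ℚᵘ.≃-sym y≈) (ℚᵘ.≤-respˡ-≃ (ℚᵘ.≃-sym x≈)
    (ℚᵘ.*≤* (subst₂ ℤ._≤_ (ℤ.pos-* a (suc e)) (ℤ.pos-* c (suc b)) (+≤+ ae≤cb)))))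

≈-< : ∀ {x y a b c e} .{{_ : NonZero b}} .{{_ : NonZero e}} →
  x ≈ a / b → y ≈ c / e → x ℚ.< y → a * e < c * b
≈-< {a = a} {suc b} {c} {suc e} x≈ y≈ x<y
  with ℚᵘ.<-respʳ-≃ y≈ (ℚᵘ.<-respˡ-≃ x≈ (ℚ.toℚᵘ-mono-< x<y))
... | ℚᵘ.*<* ae<cb = ℤ.drop‿+<+ (subst₂ ℤ._<_ (sym (ℤ.pos-* a (suc e))) (sym (ℤ.pos-* c (suc b))) ae<cb)

≈-0ℚ : 0ℚ ≈ 0 / 1
≈-0ℚ = ℚᵘ.≃-refl

≈-½ : ½ ≈ 1 / 2
≈-½ = ≈-1/ 1

^-cancelˡ-≤ : ∀ k .{{_ : NonZero k}} {m o} → m ^ k ≤ o ^ k → m ≤ o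
^-cancelˡ-≤ k {m} {o} mᵏ≤oᵏ with m ≤? o
... | yes m≤o = m≤o
... | no m≰o = contradiction mᵏ≤oᵏ (<⇒≱ (^-monoˡ-< k (≰⇒> m≰o)))

GeqσLog-mono : ∀ σ N {x y} → x ℚ.≤ y → GeqσLog σ N x → GeqσLog σ N y
GeqσLog-mono σ N {mkℚ (+ cx) dx _} {y@(mkℚ (+ cy) dy _)} x≤y@(*≤* cx*dy≤cy*dx) (0≤x , Nᵖᵈ≤2^qc) =
  ℚ.≤-trans 0≤x x≤y , ^-cancelˡ-≤ (suc dx) (begin
    (N ^ (suc dy * p)) ^ suc dx   ≡⟨ ^-*-assoc N (suc dy * p) (suc dx) ⟩
    N ^ (suc dy * p * suc dx)     ≡⟨ cong (N ^_) (swap (suc dy) p (suc dx)) ⟩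
    N ^ (suc dx * p * suc dy)     ≡⟨ ^-*-assoc N (suc dx * p) (suc dy) ⟨
    (N ^ (suc dx * p)) ^ suc dy   ≤⟨ ^-monoˡ-≤ (suc dy) Nᵖᵈ≤2^qc ⟩
    (2 ^ (q * cx)) ^ suc dy       ≡⟨ ^-*-assoc 2 (q * cx) (suc dy) ⟩
    2 ^ (q * cx * suc dy)         ≤⟨ ^-monoʳ-≤ 2 exponent≤ ⟩
    2 ^ (q * cy * suc dx)         ≡⟨ ^-*-assoc 2 (q * cy) (suc dx) ⟨
    (2 ^ (q * cy)) ^ suc dx       ∎)
  where
  open ≤-Reasoning
  p = ℤ.∣ ↥ σ ∣
  q = ↧ₙ σ
  swap : ∀ a b c → a * b * c ≡ c * b * a
  swap a b c = trans (*-comm (a * b) c) (trans (cong (c *_) (*-comm a b)) (sym (*-assoc c b a)))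
  exponent≤ : q * cx * suc dy ≤ q * cy * suc dx
  exponent≤ = begin
    q * cx * suc dy    ≡⟨ *-assoc q cx (suc dy) ⟩
    q * (cx * suc dy)  ≤⟨ *-monoʳ-≤ q (+*+≤+*+⇒*≤* cx (suc dy) cy (suc dx) cx*dy≤cy*dx) ⟩
    q * (cy * suc dx)  ≡⟨ *-assoc q cy (suc dx) ⟨
    q * cy * suc dx    ∎
GeqσLog-mono σ N {mkℚ (+ _) _ _} {mkℚ -[1+ _ ] _ _} x≤y (0≤x , _) with ℚ.≤-trans 0≤x x≤y
... | *≤* ()
GeqσLog-mono σ N {mkℚ -[1+ _ ] _ _} _ (*≤* () , _)

|tabulate|≡count : ∀ {N} (A : Fin N → Bool) → ∣ tabulate A ∣ ≡ count A
|tabulate|≡count A = trans (∣∣≡count (tabulate A)) (sum-cong-≗ (cong [_]ᵇ ∘ lookup∘tabulate A))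

edgesFromTo≡edges : ∀ {N} (G : Digraph N) (A B : Fin N → Bool) →
  edgesFromTo G (tabulate A) (tabulate B) ≡ edges G A B
edgesFromTo≡edges G A B =
  trans (Σv≡∑ (λ i → Σv (λ j → [ lookup (tabulate A) i ∧ lookup (tabulate B) j ∧ G i j ]ᵇ)))
        (sum-cong-≗ λ i → trans (Σv≡∑ (λ j → [ lookup (tabulate A) i ∧ lookup (tabulate B) j ∧ G i j ]ᵇ))
                                (sum-cong-≗ λ j → cong₂ (λ x y → [ x ∧ y ∧ G i j ]ᵇ)
                                                        (lookup∘tabulate A i) (lookup∘tabulate B j)))

blueEdgesIn≡edges : ∀ {N} (adj red : Digraph N) U →
  blueEdgesIn adj red U ≡ edges (blueGraph adj red) (lookup U) (lookup U)
blueEdgesIn≡edges adj red U =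
  trans (Σv≡∑ (λ i → Σv (λ j → [ lookup U i ∧ lookup U j ∧ blueGraph adj red i j ]ᵇ)))
        (sum-cong-≗ λ i → Σv≡∑ (λ j → [ lookup U i ∧ lookup U j ∧ blueGraph adj red i j ]ᵇ))

module _ {a d} .{c : Coprime a (suc d)} (σ : ℚ) {N} (adj red : Digraph N) (U : Subset N) where
  private
    ε = mkℚ (+ a) d c
    b = suc d
    M = ∣ U ∣
    ε≈a/b : ε ≈ a / b
    ε≈a/b = ℚᵘ.≃-refl
    εM/4≈ : ε ℚ.* (+ 1 / 4) ℚ.* ℕ→ℚ M ≈ a * 1 * M / b * 4 * 1
    εM/4≈ = ≈-* (ε ℚ.* (+ 1 / 4)) (ℕ→ℚ M) (≈-* ε (+ 1 / 4) ε≈a/b (≈-1/ 3)) (≈-ℕ→ℚ M)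
    M≡m : M ≡ count (lookup U)
    M≡m = ∣∣≡count U

  Hypotheses-from-ℚ : 0ℚ ℚ.< ε → ε ℚ.< ½ → IsPseudorandomσLog ε σ adj →
    ℕ→ℚ (blueEdgesIn adj red U) ℚ.≤ (ε ℚ.* ε ℚ.* (+ 1 / 32)) ℚ.* (ℕ→ℚ M ℚ.* ℕ→ℚ M) →
    GeqσLog σ N (ε ℚ.* (+ 1 / 4) ℚ.* ℕ→ℚ M) →
    ∀ n → ℕ→ℚ (suc n) ℚ.≤ ε ℚ.* (+ 1 / 4) ℚ.* ℕ→ℚ M →
    Hypotheses adj red (lookup U) (suc n) a b
  Hypotheses-from-ℚ 0<ε ε<½ pseudo few-blue U-large n n≤εM/4 = record
    { 0<a = subst (0 <_) (*-identityʳ a) (≈-< ≈-0ℚ ε≈a/b 0<ε)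
    ; 2a<b = subst₂ _<_ (*-comm a 2) (*-identityˡ b) (≈-< ε≈a/b ≈-½ ε<½)
    ; 0<n = z<s
    ; tree-small = subst₂ _≤_ (shape₁ (suc n) b) (trans (shape₂ a M) (cong (a *_) M≡m))
                     (≈-≤ (≈-ℕ→ℚ (suc n)) εM/4≈ n≤εM/4)
    ; few-blue = subst₂ _≤_ (trans (shape₃ β b) (cong (32 * b * b *_) (blueEdgesIn≡edges adj red U)))
                     (trans (shape₄ a M) (cong (λ m → a * a * m * m) M≡m))
                     (≈-≤ (≈-ℕ→ℚ β) ε²M²/32≈ few-blue)
    ; pseudorandom = pseudorandom
    }
    where
    shape₁ : ∀ n b → n * (b * 4 * 1) ≡ 4 * b * n
    shape₁ = solve-∀
    shape₂ : ∀ a m → a * 1 * m * 1 ≡ a * m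
    shape₂ = solve-∀
    shape₃ : ∀ β b → β * (b * b * 32 * (1 * 1)) ≡ 32 * b * b * β
    shape₃ = solve-∀
    shape₄ : ∀ a m → a * a * 1 * (m * m) * 1 ≡ a * a * m * m
    shape₄ = solve-∀
    shape₅ : ∀ a x y → a * (x * y) * 1 ≡ a * (x * y)
    shape₅ = solve-∀
    shape₆ : ∀ e b → e * (b * (1 * 1)) ≡ b * e
    shape₆ = solve-∀
    β = blueEdgesIn adj red U
    ε²M²/32≈ : (ε ℚ.* ε ℚ.* (+ 1 / 32)) ℚ.* (ℕ→ℚ M ℚ.* ℕ→ℚ M) ≈ a * a * 1 * (M * M) / b * b * 32 * (1 * 1)
    ε²M²/32≈ = ≈-* (ε ℚ.* ε ℚ.* (+ 1 / 32)) (ℕ→ℚ M ℚ.* ℕ→ℚ M)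
                 (≈-* (ε ℚ.* ε) (+ 1 / 32) (≈-* ε ε ε≈a/b ε≈a/b) (≈-1/ 31))
                 (≈-* (ℕ→ℚ M) (ℕ→ℚ M) (≈-ℕ→ℚ M) (≈-ℕ→ℚ M))
    large : ∀ A → a * count (lookup U) ≤ 4 * b * count A → GeqσLog σ N (ℕ→ℚ ∣ tabulate A ∣)
    large A am≤4bA = GeqσLog-mono σ N
      (≈-≤⁻ εM/4≈ (≈-ℕ→ℚ ∣ tabulate A ∣)
        (subst₂ _≤_ (trans (cong (a *_) (sym M≡m)) (sym (shape₂ a M)))
                      (trans (cong (4 * b *_) (sym (|tabulate|≡count A))) (sym (shape₁ ∣ tabulate A ∣ b)))
                      am≤4bA))
      U-large
    pseudorandom : ∀ A B → Disjointᵇ A B →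
      a * count (lookup U) ≤ 4 * b * count A → a * count (lookup U) ≤ 4 * b * count B →
      a * (count A * count B) ≤ b * edges adj A B
    pseudorandom A B A∩B am≤4bA am≤4bB =
      subst₂ _≤_ (trans (shape₅ a ∣A∣ ∣B∣) (cong₂ (λ x y → a * (x * y)) (|tabulate|≡count A) (|tabulate|≡count B)))
                 (trans (shape₆ e b) (cong (b *_) (edgesFromTo≡edges adj A B)))
                 (≈-≤ ε|A||B|≈ (≈-ℕ→ℚ e) (pseudo (tabulate A) (tabulate B) disjoint (large A am≤4bA) (large B am≤4bB)))
      where
      ∣A∣ = ∣ tabulate A ∣
      ∣B∣ = ∣ tabulate B ∣
      e = edgesFromTo adj (tabulate A) (tabulate B)
      ε|A||B|≈ : ε ℚ.* (ℕ→ℚ ∣A∣ ℚ.* ℕ→ℚ ∣B∣) ≈ a * (∣A∣ * ∣B∣) / b * (1 * 1)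
      ε|A||B|≈ = ≈-* ε (ℕ→ℚ ∣A∣ ℚ.* ℕ→ℚ ∣B∣) ε≈a/b (≈-* (ℕ→ℚ ∣A∣) (ℕ→ℚ ∣B∣) (≈-ℕ→ℚ ∣A∣) (≈-ℕ→ℚ ∣B∣))
      disjoint : Disjoint (tabulate A) (tabulate B)
      disjoint i (Ai , Bi) = A∩B i (subst T (lookup∘tabulate A i) Ai , subst T (lookup∘tabulate B i) Bi)

Embeds⇒HasRedCopy : ∀ {n N} {Tr : Digraph n} {adj red : Digraph N} →
  Embeds Tr (redGraph adj red) → HasRedCopy Tr adj red
Embeds⇒HasRedCopy (φ , injective , homomorphic) =
  φ , injective , λ i j → ∧⁻ ∘ homomorphic i j

lemma3p3 : (ε σ : ℚ) → 0ℚ ℚ.< ε → ε ℚ.< ½ → 0ℚ ℚ.< σ →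
    (N : ℕ) (adj : Digraph N) (red : Digraph N) →
    IsTournament adj → IsPseudorandomσLog ε σ adj →
    (U : Subset N) →
    ℕ→ℚ (blueEdgesIn adj red U) ℚ.≤ (ε ℚ.* ε ℚ.* (+ 1 / 32)) ℚ.* (ℕ→ℚ ∣ U ∣ ℚ.* ℕ→ℚ ∣ U ∣) →
    GeqσLog σ N (ε ℚ.* (+ 1 / 4) ℚ.* ℕ→ℚ ∣ U ∣) →
    (n : ℕ) → ℕ→ℚ n ℚ.≤ ε ℚ.* (+ 1 / 4) ℚ.* ℕ→ℚ ∣ U ∣ →
    (T : Digraph n) → IsOrientedTree T →
    HasRedCopy T adj red
lemma3p3 _ _ _ _ _ _ _ _ _ _ _ _ _ zero _ _ _ = (λ ()) , (λ { {()} }) , λ ()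
lemma3p3 (mkℚ -[1+ _ ] _ _) _ (*<* ()) _ _ _ _ _ _ _ _ _ _ (suc _) _ _ _
lemma3p3 (mkℚ (+ a) d _) σ 0<ε ε<½ _ N adj red _ pseudo U few-blue U-large (suc n) n≤εM/4 T tree
  with dense-core (Hypotheses-from-ℚ σ adj red U 0<ε ε<½ pseudo few-blue U-large n n≤εM/4)
... | W , (w₀ , Ww₀) , min-degree =
  Embeds⇒HasRedCopy {adj = adj} {red} (embed-tree (redGraph adj red) W T tree min-degree Fin.zero Ww₀)
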